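{- Let $T$ be a planar rooted tree and let $\rho(T)$ be the associated strict order on the non-root nodes of $T$. Label the nodes of $T$ according to the preorder traversal. Then the induced labelling of the elements of $\rho(T)$ is a preorder linear extension of $\rho(T)$; that is, listing the non-root nodes in preorder order gives a linear extension $\lambda$ of $\rho(T)$ such that $xZy$ implies $\lambda(x)<\lambda(y)$.
   Context: For a planar (ordered) rooted tree $T$, $\rho(T)$ is the binary relation $R$ on the set of non-root nodes of $T$ defined by $xRy$ iff $x$ and $y$ cannot be joined by a directed path in $T$ (i.e. neither is an ancestor of the other) and $x$ lies to the left of $y$ in $T$; $\rho(T)$ is a strict partial order, and it is a series parallel interval order (a poset with no induced $2+2$ and no induced fence $N$ of order four). The preorder traversal visits the root, then recursively the subtrees of its children from left to right. For a binary relation $B$ write $\overline{B}=B\cup B^{ -1}$; define $Z=Z(R)$ by $xZy$ iff $(x,y)\notin\overline{R}$ and there exists $z$ with $z\overline{R}y$ and $(z,x)\notin\overline{R}$. A linear extension of $R$ on a set $X$ is a bijection $\lambda:X\to\{1,\dots,|X|\}$ with $xRy\Rightarrow\lambda(x)<\lambda(y)$; it is a preorder linear extension if moreover $xZy\Rightarrow\lambda(x)<\lambda(y)$. -}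

module Defs where

open import Data.Nat using (ℕ; zero; suc; _+_; _<_; _≤_)
open import Data.Fin using (Fin; zero; suc; toℕ)
open import Data.List using (List; []; _∷_; length; lookup; map; _++_)
open import Data.Maybe using (Maybe; just; nothing)
open import Data.Product using (Σ; _×_; _,_; ∃; proj₁)
open import Data.Sum using (_⊎_)
open import Data.Unit using (⊤)
open import Data.Empty using (⊥)
open import Relation.Nullary using (¬_)
open import Relation.Binary.PropositionalEquality using (_≡_)

data Tree : Set where
  node : List Tree → Tree

-- Nodes of a tree, addressed by the path from the root
-- ('here' = the root; 'there i p' = node p in the subtree of the i-th child).
data Pos : Tree → Set where
  here  : ∀ {t} → Pos t
  there : ∀ {ts} (i : Fin (length ts)) → Pos (lookup ts i) → Pos (node ts)

IsNonRoot : ∀ {t} → Pos t → Set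
IsNonRoot here        = ⊥
IsNonRoot (there _ _) = ⊤

NonRoot : Tree → Set
NonRoot t = Σ (Pos t) IsNonRoot

mutual
  size : Tree → ℕ
  size (node ts) = suc (sizes ts)

  sizes : List Tree → ℕ
  sizes []       = zero
  sizes (t ∷ ts) = size t + sizes ts

nonRootCount : Tree → ℕ
nonRootCount (node ts) = sizes ts

-- x is an ancestor of y (or equal): there is a directed path from x to y
data _≼_ : ∀ {t} → Pos t → Pos t → Set where
  base : ∀ {t} {p : Pos t} → here ≼ p
  step : ∀ {ts} {i : Fin (length ts)} {p q : Pos (lookup ts i)} →
         p ≼ q → there {ts} i p ≼ there {ts} i q

data LeftOf : ∀ {t} → Pos t → Pos t → Set where
  diff : ∀ {ts} {i j : Fin (length ts)} {p : Pos (lookup ts i)} {q : Pos (lookup ts j)} →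
         toℕ i < toℕ j → LeftOf (there {ts} i p) (there {ts} j q)
  same : ∀ {ts} {i : Fin (length ts)} {p q : Pos (lookup ts i)} →
         LeftOf p q → LeftOf (there {ts} i p) (there {ts} i q)

ρ : (t : Tree) → NonRoot t → NonRoot t → Set
ρ t (x , _) (y , _) = ¬ (x ≼ y) × ¬ (y ≼ x) × LeftOf x y

sym-closure : {X : Set} → (X → X → Set) → X → X → Set
sym-closure B x y = B x y ⊎ B y x

Z : {X : Set} → (X → X → Set) → X → X → Set
Z R x y = ¬ sym-closure R x y × ∃ λ z → sym-closure R z y × ¬ sym-closure R z x

IsLinearExtension : {X : Set} (n : ℕ) (R : X → X → Set) (λ' : X → ℕ) → Set
IsLinearExtension {X} n R λ' =
  (∀ x → 1 ≤ λ' x × λ' x ≤ n) ×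
  (∀ x y → λ' x ≡ λ' y → x ≡ y) ×
  (∀ k → 1 ≤ k → k ≤ n → ∃ λ x → λ' x ≡ k) ×
  (∀ x y → R x y → λ' x < λ' y)

IsPreorderLinearExtension : {X : Set} (n : ℕ) (R : X → X → Set) (λ' : X → ℕ) → Set
IsPreorderLinearExtension n R λ' =
  IsLinearExtension n R λ' × (∀ x y → Z R x y → λ' x < λ' y)

mutual
  preorder : (t : Tree) → List (Pos t)
  preorder (node ts) = here ∷ map (λ { (i , p) → there i p }) (childrenPreorder ts)

  childrenPreorder : (ts : List Tree) → List (Σ (Fin (length ts)) λ i → Pos (lookup ts i))
  childrenPreorder []       = []
  childrenPreorder (t ∷ ts) =
    map (λ p → (zero , p)) (preorder t) ++
    map (λ { (i , p) → (suc i , p) }) (childrenPreorder ts)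

-- k-th entry of a list (0-based)
nth : {A : Set} → List A → ℕ → Maybe A
nth []       _       = nothing
nth (x ∷ xs) zero    = just x
nth (x ∷ xs) (suc k) = nth xs k

-- The preorder index of the i-th child subtree
-- starts right after the subtrees of the children to its left, so a node left
-- of another gets a smaller index, and so does a proper ancestor. For Z x y,
-- x and y are ρ-incomparable, so either x lies left of y or one is an ancestor
-- of the other; y cannot be a proper ancestor of x, since every node
-- ρ-comparable with y would then be ρ-comparable with x, contradicting the
-- witness z.
module Submission where

open import Defs
open import Data.Nat using (ℕ; zero; suc; _+_; _<_; _≤_; z≤n; s≤s)
open import Data.Nat.Properties
open import Data.Fin using (Fin; zero; suc; toℕ)
open import Data.Fin.Properties using (toℕ-injective)
open import Data.List using (List; []; _∷_; length; lookup; map; _++_)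
open import Data.List.Properties using (length-map; length-++)
open import Data.Maybe using (just)
import Data.Maybe as Maybe
open import Data.Maybe.Properties using (just-injective)
open import Data.Product using (Σ; _×_; _,_; proj₁; proj₂; ∃)
open import Data.Sum using (_⊎_; inj₁; inj₂; [_,_])
open import Data.Unit using (tt)
open import Data.Empty using (⊥-elim)
open import Relation.Nullary using (¬_)
open import Relation.Binary using (tri<; tri≈; tri>)
open import Relation.Binary.PropositionalEquality
  using (_≡_; refl; sym; trans; cong; cong₂; subst; module ≡-Reasoning)

nth-map : {A B : Set} (f : A → B) (xs : List A) (k : ℕ) →
          nth (map f xs) k ≡ Maybe.map f (nth xs k)
nth-map f []       k       = refl
nth-map f (x ∷ xs) zero    = refl
nth-map f (x ∷ xs) (suc k) = nth-map f xs k

nth-++ˡ : {A : Set} (xs ys : List A) (k : ℕ) {a : A} →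
          nth xs k ≡ just a → nth (xs ++ ys) k ≡ just a
nth-++ˡ (x ∷ xs) ys zero    e = e
nth-++ˡ (x ∷ xs) ys (suc k) e = nth-++ˡ xs ys k e

nth-++ʳ : {A : Set} (xs ys : List A) (k : ℕ) → nth (xs ++ ys) (length xs + k) ≡ nth ys k
nth-++ʳ []       ys k = refl
nth-++ʳ (x ∷ xs) ys k = nth-++ʳ xs ys k

<-split-+ : ∀ m {n} k → k < m + n → k < m ⊎ Σ ℕ λ j → j < n × m + j ≡ k
<-split-+ zero    k       lt      = inj₂ (k , lt , refl)
<-split-+ (suc m) zero    _       = inj₁ (s≤s z≤n)
<-split-+ (suc m) (suc k) (s≤s lt) with <-split-+ m k lt
... | inj₁ k<m           = inj₁ (s≤s k<m)
... | inj₂ (j , j<n , e) = inj₂ (j , j<n , cong suc e)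

offset : (ts : List Tree) → Fin (length ts) → ℕ
offset (t ∷ ts) zero    = 0
offset (t ∷ ts) (suc i) = size t + offset ts i

preorderIndex : ∀ {t} → Pos t → ℕ
preorderIndex here             = 0
preorderIndex (there {ts} i p) = suc (offset ts i + preorderIndex p)

mutual
  length-preorder : (t : Tree) → length (preorder t) ≡ size t
  length-preorder (node ts) =
    cong suc (trans (length-map _ (childrenPreorder ts)) (length-childrenPreorder ts))

  length-childrenPreorder : (ts : List Tree) → length (childrenPreorder ts) ≡ sizes ts
  length-childrenPreorder []       = refl
  length-childrenPreorder (t ∷ ts) =
    trans (length-++ (map _ (preorder t)))
          (cong₂ _+_ (trans (length-map _ (preorder t)) (length-preorder t))
                     (trans (length-map _ (childrenPreorder ts)) (length-childrenPreorder ts)))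

mutual
  nth-preorder : (t : Tree) (p : Pos t) → nth (preorder t) (preorderIndex p) ≡ just p
  nth-preorder (node ts) here        = refl
  nth-preorder (node ts) (there i p) =
    trans (nth-map _ (childrenPreorder ts) (offset ts i + preorderIndex p))
          (cong (Maybe.map _) (nth-childrenPreorder ts i p))

  nth-childrenPreorder : (ts : List Tree) (i : Fin (length ts)) (p : Pos (lookup ts i)) →
    nth (childrenPreorder ts) (offset ts i + preorderIndex p) ≡ just (i , p)
  nth-childrenPreorder (t ∷ ts) zero p =
    nth-++ˡ (map _ (preorder t)) _ (preorderIndex p)
      (trans (nth-map _ (preorder t) (preorderIndex p)) (cong (Maybe.map _) (nth-preorder t p)))
  nth-childrenPreorder (t ∷ ts) (suc i) p = begin
    nth (firsts ++ rests) (size t + offset ts i + k)    ≡⟨ cong (nth (firsts ++ rests)) shift ⟩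
    nth (firsts ++ rests) (length firsts + (offset ts i + k))
                                                        ≡⟨ nth-++ʳ firsts rests _ ⟩
    nth rests (offset ts i + k)                         ≡⟨ nth-map _ (childrenPreorder ts) _ ⟩
    Maybe.map _ (nth (childrenPreorder ts) (offset ts i + k))
                                                        ≡⟨ cong (Maybe.map _) (nth-childrenPreorder ts i p) ⟩
    just (suc i , p)                                    ∎
    where
    open ≡-Reasoning
    k = preorderIndex p
    firsts = map (λ q → (zero , q)) (preorder t)
    rests  = map (λ { (j , q) → (suc j , q) }) (childrenPreorder ts)
    shift : size t + offset ts i + k ≡ length firsts + (offset ts i + k)
    shift = trans (+-assoc (size t) (offset ts i) k)
                  (cong (_+ (offset ts i + k))
                        (sym (trans (length-map _ (preorder t)) (length-preorder t))))

offset+size≤sizes : (ts : List Tree) (i : Fin (length ts)) →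
                    offset ts i + size (lookup ts i) ≤ sizes ts
offset+size≤sizes (t ∷ ts) zero    = m≤m+n (size t) (sizes ts)
offset+size≤sizes (t ∷ ts) (suc i) =
  subst (_≤ size t + sizes ts) (sym (+-assoc (size t) (offset ts i) _))
        (+-monoʳ-≤ (size t) (offset+size≤sizes ts i))

offset+size≤offset : (ts : List Tree) (i j : Fin (length ts)) → toℕ i < toℕ j →
                     offset ts i + size (lookup ts i) ≤ offset ts j
offset+size≤offset (t ∷ ts) zero    (suc j) _        = m≤m+n (size t) (offset ts j)
offset+size≤offset (t ∷ ts) (suc i) (suc j) (s≤s lt) =
  subst (_≤ size t + offset ts j) (sym (+-assoc (size t) (offset ts i) _))
        (+-monoʳ-≤ (size t) (offset+size≤offset ts i j lt))

preorderIndex<size : ∀ {t} (p : Pos t) → preorderIndex p < size t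
preorderIndex<size {node ts} here = s≤s z≤n
preorderIndex<size (there {ts} i p) =
  s≤s (≤-trans (+-monoʳ-< (offset ts i) (preorderIndex<size p)) (offset+size≤sizes ts i))

mutual
  preorderIndex-surjective : (t : Tree) (k : ℕ) → k < size t → ∃ λ p → preorderIndex {t} p ≡ k
  preorderIndex-surjective (node ts) zero    _        = here , refl
  preorderIndex-surjective (node ts) (suc k) (s≤s lt) with childrenIndex-surjective ts k lt
  ... | i , p , e = there i p , cong suc e

  childrenIndex-surjective : (ts : List Tree) (k : ℕ) → k < sizes ts →
    Σ (Fin (length ts)) λ i → Σ (Pos (lookup ts i)) λ p → offset ts i + preorderIndex p ≡ k
  childrenIndex-surjective (t ∷ ts) k lt with <-split-+ (size t) k lt
  ... | inj₁ k<size with preorderIndex-surjective t k k<size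
  ...   | p , e = zero , p , e
  childrenIndex-surjective (t ∷ ts) k lt | inj₂ (j , j<sizes , e)
    with childrenIndex-surjective ts j j<sizes
  ... | i , p , e′ =
    suc i , p , trans (+-assoc (size t) (offset ts i) _) (trans (cong (size t +_) e′) e)

≼-trans : ∀ {t} {a b c : Pos t} → a ≼ b → b ≼ c → a ≼ c
≼-trans base     _        = base
≼-trans (step p) (step q) = step (≼-trans p q)

ancestors-comparable : ∀ {t} {a b c : Pos t} → a ≼ c → b ≼ c → a ≼ b ⊎ b ≼ a
ancestors-comparable base     _        = inj₁ base
ancestors-comparable (step p) base     = inj₂ base
ancestors-comparable (step p) (step q) with ancestors-comparable p q
... | inj₁ a≼b = inj₁ (step a≼b)
... | inj₂ b≼a = inj₂ (step b≼a)

leftOf-descendantʳ : ∀ {t} {a b c : Pos t} → LeftOf a b → b ≼ c → LeftOf a c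
leftOf-descendantʳ (diff lt) (step _) = diff lt
leftOf-descendantʳ (same l)  (step s) = same (leftOf-descendantʳ l s)

leftOf-descendantˡ : ∀ {t} {a b c : Pos t} → LeftOf b a → b ≼ c → LeftOf c a
leftOf-descendantˡ (diff lt) (step _) = diff lt
leftOf-descendantˡ (same l)  (step s) = same (leftOf-descendantˡ l s)

leftOf⇒⋠ : ∀ {t} {a b : Pos t} → LeftOf a b → ¬ (a ≼ b)
leftOf⇒⋠ (diff lt) (step _) = <-irrefl refl lt
leftOf⇒⋠ (same l)  (step s) = leftOf⇒⋠ l s

leftOf⇒⋡ : ∀ {t} {a b : Pos t} → LeftOf a b → ¬ (b ≼ a)
leftOf⇒⋡ (diff lt) (step _) = <-irrefl refl lt
leftOf⇒⋡ (same l)  (step s) = leftOf⇒⋡ l s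

data Placement {t : Tree} (x y : Pos t) : Set where
  ancestor   : x ≼ y → Placement x y
  descendant : y ≼ x → Placement x y
  left       : LeftOf x y → Placement x y
  right      : LeftOf y x → Placement x y

placement : ∀ {t} (x y : Pos t) → Placement x y
placement here        y           = ancestor base
placement (there i p) here        = descendant base
placement (there i p) (there j q) with <-cmp (toℕ i) (toℕ j)
... | tri< i<j _ _ = left (diff i<j)
... | tri> _ _ j<i = right (diff j<i)
... | tri≈ _ i≡j _ with toℕ-injective i≡j
...   | refl with placement p q
...     | ancestor s   = ancestor (step s)
...     | descendant s = descendant (step s)
...     | left l       = left (same l)
...     | right l      = right (same l)

leftOf⇒preorderIndex< : ∀ {t} {x y : Pos t} → LeftOf x y → preorderIndex x < preorderIndex y
leftOf⇒preorderIndex< (diff {ts} {i} {j} {p} {q} i<j) =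
  s≤s (≤-trans (+-monoʳ-< (offset ts i) (preorderIndex<size p))
      (≤-trans (offset+size≤offset ts i j i<j) (m≤m+n (offset ts j) (preorderIndex q))))
leftOf⇒preorderIndex< (same {ts} {i} l) =
  s≤s (+-monoʳ-< (offset ts i) (leftOf⇒preorderIndex< l))

≼⇒≡⊎preorderIndex< : ∀ {t} {x y : Pos t} → x ≼ y → x ≡ y ⊎ preorderIndex x < preorderIndex y
≼⇒≡⊎preorderIndex< (base {p = here})      = inj₁ refl
≼⇒≡⊎preorderIndex< (base {p = there i p}) = inj₂ (s≤s z≤n)
≼⇒≡⊎preorderIndex< (step {ts} {i} s) with ≼⇒≡⊎preorderIndex< s
... | inj₁ refl = inj₁ refl
... | inj₂ lt   = inj₂ (s≤s (+-monoʳ-< (offset ts i) lt))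

module _ (t : Tree) where

  label : NonRoot t → ℕ
  label (x , _) = preorderIndex x

  nonRoot-≡ : (x y : NonRoot t) → proj₁ x ≡ proj₁ y → x ≡ y
  nonRoot-≡ (there i p , tt) (.(there i p) , tt) refl = refl

  label-injective : ∀ x y → label x ≡ label y → x ≡ y
  label-injective x y e = nonRoot-≡ x y (just-injective (begin
    just (proj₁ x)              ≡⟨ sym (nth-preorder t (proj₁ x)) ⟩
    nth (preorder t) (label x)  ≡⟨ cong (nth (preorder t)) e ⟩
    nth (preorder t) (label y)  ≡⟨ nth-preorder t (proj₁ y) ⟩
    just (proj₁ y)              ∎))
    where open ≡-Reasoning

  ρ̄-descendant : (z y x : NonRoot t) → proj₁ y ≼ proj₁ x →
                 sym-closure (ρ t) z y → sym-closure (ρ t) z x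
  ρ̄-descendant (z , _) (y , _) (x , _) y≼x (inj₁ (z⋠y , y⋠z , l)) =
    inj₁ ( (λ z≼x → [ z⋠y , y⋠z ] (ancestors-comparable z≼x y≼x))
         , (λ x≼z → y⋠z (≼-trans y≼x x≼z))
         , leftOf-descendantʳ l y≼x)
  ρ̄-descendant (z , _) (y , _) (x , _) y≼x (inj₂ (y⋠z , z⋠y , l)) =
    inj₂ ( (λ x≼z → y⋠z (≼-trans y≼x x≼z))
         , (λ z≼x → [ z⋠y , y⋠z ] (ancestors-comparable z≼x y≼x))
         , leftOf-descendantˡ l y≼x)

  Z⇒label< : ∀ x y → Z (ρ t) x y → label x < label y
  Z⇒label< x y (x≁y , z , z∼y , z≁x) with placement (proj₁ x) (proj₁ y)
  ... | left l       = leftOf⇒preorderIndex< l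
  ... | right l      = ⊥-elim (x≁y (inj₂ (leftOf⇒⋠ l , leftOf⇒⋡ l , l)))
  ... | descendant s = ⊥-elim (z≁x (ρ̄-descendant z y x s z∼y))
  ... | ancestor s with ≼⇒≡⊎preorderIndex< s
  ...   | inj₂ lt = lt
  ...   | inj₁ e  = ⊥-elim (z≁x (subst (sym-closure (ρ t) z) (sym (nonRoot-≡ x y e)) z∼y))

mainTheorem3 : (t : Tree) →
    Σ (NonRoot t → ℕ) (λ lab →
      (∀ x → nth (preorder t) (lab x) ≡ just (proj₁ x)) ×
      IsPreorderLinearExtension (nonRootCount t) (ρ t) lab)
mainTheorem3 t@(node ts) =
  label t , (λ x → nth-preorder t (proj₁ x)) ,
  ((bounds , label-injective t , surjective , λ x y r → leftOf⇒preorderIndex< (proj₂ (proj₂ r))) ,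
   Z⇒label< t)
  where
  bounds : ∀ x → 1 ≤ label t x × label t x ≤ sizes ts
  bounds (p@(there _ _) , _) with preorderIndex<size {t} p
  ... | s≤s b = s≤s z≤n , b

  surjective : ∀ k → 1 ≤ k → k ≤ sizes ts → ∃ λ x → label t x ≡ k
  surjective (suc k) _ k<sizes with childrenIndex-surjective ts k k<sizes
  ... | i , p , e = (there i p , tt) , cong suc e
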